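{- Let $A$ be a finite alphabet and $f\colon A^*\to A^*$ a Parikh-collinear morphism prolongable on $a\in A$, such that every letter of $A$ occurs in $f^n(a)$ for some $n$, and such that $\mathbf{x}=f^{\omega}(a)$ is aperiodic (not ultimately periodic). Let $k=\sum_{b\in A}|f(b)|_b$ be the eigenvalue of $f$. Then the cutting set $\mathsf{CS}_{f,a}=\{|f(\mathrm{pref}_n(\mathbf{x}))|\colon n\ge0\}$ is $k$-definable.
   Context: A morphism is Parikh-collinear if the Parikh vectors (vectors of letter counts) of the images of letters are pairwise $\mathbb{Z}$-linearly dependent; it may be erasing. $f$ is prolongable on $a$ if $f(a)=au$ and $|f^n(a)|\to\infty$; $f^{\omega}(a)=\lim_n f^n(a)$. $\mathrm{pref}_n(\mathbf{x})$ denotes the length-$n$ prefix of $\mathbf{x}$. A set $E\subseteq\mathbb{N}$ is $k$-definable if it is first-order definable in the structure $\langle\mathbb{N},+,V_k\rangle$ (where $V_k(n)$ is the largest power of $k$ dividing $n$), equivalently the set of base-$k$ representations of its elements is a regular language. -}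

module Defs where

open import Data.Nat using (ℕ; zero; suc; _+_; _*_; _≤_; _<_)
open import Data.Integer as ℤ using (ℤ)
open import Data.Fin using (Fin; toℕ; fromℕ<) renaming (zero to fzero)
open import Data.Fin.Properties using (_≟_)
open import Data.List using (List; []; _∷_; length; concatMap; foldl; map; allFin; lookup)
open import Data.Nat.ListAction using (sum)
open import Data.List.Membership.Propositional using (_∈_)
open import Data.Bool using (Bool; true; false)
open import Data.Product using (Σ; ∃; _×_; _,_)
open import Relation.Binary.PropositionalEquality using (_≡_; _≢_)
open import Relation.Nullary using (¬_; yes; no)
open import Function.Bundles using (_⇔_)

Word : ℕ → Set
Word s = List (Fin s)

Morphism : ℕ → Set
Morphism s = Fin s → Word s

apply : ∀ {s} → Morphism s → Word s → Word s
apply f w = concatMap f w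

iter : ∀ {s} → Morphism s → ℕ → Word s → Word s
iter f zero    w = w
iter f (suc n) w = apply f (iter f n w)

count : ∀ {s} → Fin s → Word s → ℕ
count b []      = 0
count b (c ∷ w) with b ≟ c
... | yes _ = suc (count b w)
... | no  _ = count b w

parikh : ∀ {s} → Word s → Fin s → ℤ
parikh w b = ℤ.+ (count b w)

ZLinDep : ∀ {s} → (Fin s → ℤ) → (Fin s → ℤ) → Set
ZLinDep u v = Σ ℤ λ p → Σ ℤ λ q → ¬ (p ≡ ℤ.0ℤ × q ≡ ℤ.0ℤ) ×
  (∀ d → p ℤ.* u d ℤ.+ q ℤ.* v d ≡ ℤ.0ℤ)

ParikhCollinear : ∀ {s} → Morphism s → Set
ParikhCollinear f = ∀ b c → ZLinDep (parikh (f b)) (parikh (f c))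

Prolongable : ∀ {s} → Morphism s → Fin s → Set
Prolongable f a =
  (Σ (Word _) λ u → f a ≡ a ∷ u) ×
  (∀ N → ∃ λ n → N ≤ length (iter f n (a ∷ [])))

-- x is the infinite word f^ω(a): it extends every f^n(a)
IsFixedPointWord : ∀ {s} → Morphism s → Fin s → (ℕ → Fin s) → Set
IsFixedPointWord f a x =
  ∀ n i (h : i < length (iter f n (a ∷ []))) → x i ≡ lookup (iter f n (a ∷ [])) (fromℕ< h)

UltPeriodic : ∀ {s} → (ℕ → Fin s) → Set
UltPeriodic x = Σ ℕ λ p → Σ ℕ λ N → (0 < p) × (∀ i → N ≤ i → x (i + p) ≡ x i)

pref : ∀ {s} → ℕ → (ℕ → Fin s) → Word s
pref zero    x = []
pref (suc n) x = pref n x Data.List.++ (x n ∷ [])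

eigenvalue : ∀ {s} → Morphism s → ℕ
eigenvalue {s} f = sum (map (λ b → count b (f b)) (allFin s))

CuttingSet : ∀ {s} → Morphism s → (ℕ → Fin s) → ℕ → Set
CuttingSet f x m = ∃ λ n → length (apply f (pref n x)) ≡ m

record DFA (k : ℕ) : Set where
  field
    nstates : ℕ
    start   : Fin nstates
    δ       : Fin nstates → Fin k → Fin nstates
    final   : Fin nstates → Bool

accepts : ∀ {k} → DFA k → List (Fin k) → Bool
accepts D w = DFA.final D (foldl (DFA.δ D) (DFA.start D) w)

-- value of a base-k digit word, most significant digit first
val : (k : ℕ) → List (Fin k) → ℕ
val k = foldl (λ acc d → acc * k + toℕ d) 0

-- canonical base-k representation: no leading zero (0 is represented by the empty word)
data NoLeadingZero {k : ℕ} : List (Fin k) → Set where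
  nlz-[] : NoLeadingZero []
  nlz-∷  : ∀ {d w} → toℕ d ≢ 0 → NoLeadingZero (d ∷ w)

KDefinable : ℕ → (ℕ → Set) → Set
KDefinable k E = Σ (DFA k) λ D →
  ∀ w → (accepts D w ≡ true) ⇔ (NoLeadingZero w × E (val k w))

{-# OPTIONS --safe #-}
module Submission where

open import Defs
open import Data.Nat using (ℕ)
open import Data.Fin using (Fin)
open import Data.List using ([]; _∷_)
open import Data.List.Membership.Propositional using (_∈_)
open import Data.Product using (∃; _,_)
open import Relation.Nullary using (¬_)

open import Data.Bool using (Bool; true; false)
open import Data.Fin using (zero; suc; toℕ; fromℕ<; punchIn; combine; remQuot)
open import Data.Fin.Properties using (_≟_; toℕ<n; toℕ-fromℕ<; punchInᵢ≢i; remQuot-combine)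
open import Data.Integer as ℤ using (ℤ; 0ℤ)
import Data.Integer.Properties as ℤ
import Data.Integer.Tactic.RingSolver as ℤ-Ring
open import Data.List as List using (List; _++_; length; foldl; lookup; take; drop)
open import Data.List.Properties
  using (length-++; length-take; ++-identityʳ; ++-assoc; take++drop≡id;
         concatMap-++; concatMap-pure; map-tabulate)
open import Data.Maybe using (Maybe; just; nothing)
import Data.Nat as ℕ
open import Data.Nat using (zero; suc; _+_; _*_; _∸_; _≤_; _<_; z≤n; s≤s; s≤s⁻¹)
import Data.Nat.ListAction as ListAction
open import Data.Nat.Properties hiding (_≟_)
open import Data.Nat.Tactic.RingSolver using (solve-∀)
open import Algebra.Properties.Semiring.Sum +-*-semiring
  using (sum-syntax; sum-cong-≗; sum-remove; sum-replicate-zero; *-distribˡ-sum; *-distribʳ-sum)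
open import Data.Product using (Σ; _×_; proj₁; proj₂; uncurry)
open import Data.Sum using (inj₁; inj₂)
open import Data.Unit using (⊤; tt)
open import Function using (_∘_)
open import Function.Bundles using (_⇔_; mk⇔; Equivalence)
open import Function.Construct.Composition using (_⇔-∘_)
open import Relation.Binary.PropositionalEquality
open import Relation.Nullary using (Dec; yes; no; contradiction)

-- Write cut n = |f(pref n x)|; the cutting set is the image of cut, and x = f(x) is the
-- concatenation of the blocks f(x n), the n-th one starting at position cut n.
-- Parikh-collinearity makes every 2×2 minor of the Parikh vectors of the images f(b) vanish,
-- which gives |f(f(b))| = k·|f(b)|, hence |f(f(w))| = k·|f(w)| for every word w.
-- So if q = cut n + g lies at offset g in the block f(b), b = x n, then for a digit r < k the
-- position qk + r = k·cut n + (gk + r) lies in f(f(b)), which x contains from position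
-- k·cut n on: it falls into the block f(c) of the letter c of f(b) covering position gk + r of
-- f(f(b)), at an offset determined by b, g and r alone. Reading the base-k digits of q thus runs
-- a finite automaton on pairs (letter, offset), and q is a cutting point iff the final offset is 0.

private variable
  s : ℕ

m<n∧r<o⇒m*o+r<n*o : ∀ {m n o r} → m < n → r < o → m * o + r < n * o
m<n∧r<o⇒m*o+r<n*o {m} {n} {o} {r} m<n r<o = begin-strict
  m * o + r  <⟨ +-monoʳ-< (m * o) r<o ⟩
  m * o + o  ≡⟨ +-comm (m * o) o ⟩
  suc m * o  ≤⟨ *-monoˡ-≤ o m<n ⟩
  n * o      ∎
  where open ≤-Reasoning

horner-distrib : ∀ k p g r → k * p + (g * k + r) ≡ (p + g) * k + r
horner-distrib = solve-∀

≤-∑ : ∀ {n} (t : Fin n → ℕ) i → t i ≤ ∑[ j < n ] t j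
≤-∑ {suc n} t i = subst (t i ≤_) (sym (sum-remove {i = i} t)) (m≤m+n (t i) _)

nonzero-annihilator : ∀ {p q t : ℤ} → ¬ (p ≡ 0ℤ × q ≡ 0ℤ) →
  p ℤ.* t ≡ 0ℤ → q ℤ.* t ≡ 0ℤ → t ≡ 0ℤ
nonzero-annihilator {p} {q} nonzero pt≡0 qt≡0
  with ℤ.i*j≡0⇒i≡0∨j≡0 p pt≡0 | ℤ.i*j≡0⇒i≡0∨j≡0 q qt≡0
... | inj₂ t≡0 | _         = t≡0
... | inj₁ _   | inj₂ t≡0  = t≡0
... | inj₁ p≡0 | inj₁ q≡0  = contradiction (p≡0 , q≡0) nonzero

ZLinDep⇒minor≡ : ∀ {u v : Fin s → ℤ} → ZLinDep u v → ∀ c d → u c ℤ.* v d ≡ v c ℤ.* u d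
ZLinDep⇒minor≡ {u = u} {v} (p , q , nonzero , dep) c d =
  ℤ.i-j≡0⇒i≡j _ _ (nonzero-annihilator nonzero p*minor≡0 q*minor≡0)
  where
  open ≡-Reasoning
  minor : ℤ
  minor = u c ℤ.* v d ℤ.- v c ℤ.* u d

  eliminate-q : ∀ p q a b c d →
    p ℤ.* (a ℤ.* d ℤ.- b ℤ.* c) ≡ (p ℤ.* a ℤ.+ q ℤ.* b) ℤ.* d ℤ.- b ℤ.* (p ℤ.* c ℤ.+ q ℤ.* d)
  eliminate-q = ℤ-Ring.solve-∀

  eliminate-p : ∀ p q a b c d →
    q ℤ.* (a ℤ.* d ℤ.- b ℤ.* c) ≡ a ℤ.* (p ℤ.* c ℤ.+ q ℤ.* d) ℤ.- (p ℤ.* a ℤ.+ q ℤ.* b) ℤ.* c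
  eliminate-p = ℤ-Ring.solve-∀

  p*minor≡0 : p ℤ.* minor ≡ 0ℤ
  p*minor≡0 = begin
    p ℤ.* minor
      ≡⟨ eliminate-q p q (u c) (v c) (u d) (v d) ⟩
    (p ℤ.* u c ℤ.+ q ℤ.* v c) ℤ.* v d ℤ.- v c ℤ.* (p ℤ.* u d ℤ.+ q ℤ.* v d)
      ≡⟨ cong₂ (λ α β → α ℤ.* v d ℤ.- v c ℤ.* β) (dep c) (dep d) ⟩
    0ℤ ℤ.* v d ℤ.- v c ℤ.* 0ℤ
      ≡⟨ cong₂ ℤ._-_ (ℤ.*-zeroˡ (v d)) (ℤ.*-zeroʳ (v c)) ⟩
    0ℤ ∎

  q*minor≡0 : q ℤ.* minor ≡ 0ℤ
  q*minor≡0 = begin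
    q ℤ.* minor
      ≡⟨ eliminate-p p q (u c) (v c) (u d) (v d) ⟩
    u c ℤ.* (p ℤ.* u d ℤ.+ q ℤ.* v d) ℤ.- (p ℤ.* u c ℤ.+ q ℤ.* v c) ℤ.* u d
      ≡⟨ cong₂ (λ α β → u c ℤ.* α ℤ.- β ℤ.* u d) (dep d) (dep c) ⟩
    u c ℤ.* 0ℤ ℤ.- 0ℤ ℤ.* u d
      ≡⟨ cong₂ ℤ._-_ (ℤ.*-zeroʳ (u c)) (ℤ.*-zeroˡ (u d)) ⟩
    0ℤ ∎

count-here : ∀ (b : Fin s) w → count b (b ∷ w) ≡ suc (count b w)
count-here b w with b ≟ b
... | yes _   = refl
... | no b≢b  = contradiction refl b≢b

count-there : ∀ {b c : Fin s} {w} → b ≢ c → count b (c ∷ w) ≡ count b w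
count-there {b = b} {c} b≢c with b ≟ c
... | yes b≡c = contradiction b≡c b≢c
... | no _    = refl

∑-count-∷ : ∀ (c : Fin s) w (g : Fin s → ℕ) →
  ∑[ b < s ] (count b (c ∷ w) * g b) ≡ g c + ∑[ b < s ] (count b w * g b)
∑-count-∷ {suc s} c w g = begin
  ∑[ b < suc s ] (count b (c ∷ w) * g b)
    ≡⟨ sum-remove {i = c} (λ b → count b (c ∷ w) * g b) ⟩
  count c (c ∷ w) * g c + ∑[ i < s ] (count (punchIn c i) (c ∷ w) * g (punchIn c i))
    ≡⟨ cong₂ _+_ (cong (_* g c) (count-here c w))
                 (sum-cong-≗ λ i → cong (_* g (punchIn c i)) (count-there (punchInᵢ≢i c i))) ⟩
  g c + count c w * g c + ∑[ i < s ] (count (punchIn c i) w * g (punchIn c i))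
    ≡⟨ +-assoc (g c) _ _ ⟩
  g c + (count c w * g c + ∑[ i < s ] (count (punchIn c i) w * g (punchIn c i)))
    ≡⟨ cong (g c +_) (sum-remove {i = c} (λ b → count b w * g b)) ⟨
  g c + ∑[ b < suc s ] (count b w * g b) ∎
  where open ≡-Reasoning

length-apply≡∑ : ∀ (f : Morphism s) w → length (apply f w) ≡ ∑[ c < s ] (count c w * length (f c))
length-apply≡∑ {s} f []      = sym (sum-replicate-zero s)
length-apply≡∑ {s} f (c ∷ w) = begin
  length (f c ++ apply f w)                         ≡⟨ length-++ (f c) ⟩
  length (f c) + length (apply f w)                 ≡⟨ cong (length (f c) +_) (length-apply≡∑ f w) ⟩
  length (f c) + ∑[ b < s ] (count b w * length (f b)) ≡⟨ ∑-count-∷ c w (length ∘ f) ⟨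
  ∑[ b < s ] (count b (c ∷ w) * length (f b))         ∎
  where open ≡-Reasoning

length≡∑count : ∀ (w : Word s) → length w ≡ ∑[ c < s ] count c w
length≡∑count {s} w = begin
  length w                              ≡⟨ cong length (concatMap-pure w) ⟨
  length (apply List.[_] w)             ≡⟨ length-apply≡∑ List.[_] w ⟩
  ∑[ c < s ] (count c w * 1)              ≡⟨ sum-cong-≗ (λ c → *-identityʳ (count c w)) ⟩
  ∑[ c < s ] count c w                  ∎
  where open ≡-Reasoning

listSum-tabulate : ∀ {n} (g : Fin n → ℕ) → ListAction.sum (List.tabulate g) ≡ ∑[ i < n ] g i
listSum-tabulate {zero}  g = refl
listSum-tabulate {suc n} g = cong (g zero +_) (listSum-tabulate (g ∘ suc))

eigenvalue≡∑ : ∀ (f : Morphism s) → eigenvalue f ≡ ∑[ b < s ] count b (f b)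
eigenvalue≡∑ f = trans (cong ListAction.sum (map-tabulate (λ b → b) (λ b → count b (f b))))
                       (listSum-tabulate (λ b → count b (f b)))

length-apply-++ : ∀ (f : Morphism s) u v →
  length (apply f (u ++ v)) ≡ length (apply f u) + length (apply f v)
length-apply-++ f u v = trans (cong length (concatMap-++ f u v)) (length-++ (apply f u))

module _ (f : Morphism s) (pc : ParikhCollinear f) where

  parikhCollinear⇒count-minor≡ : ∀ b c d → count c (f b) * count d (f c) ≡ count c (f c) * count d (f b)
  parikhCollinear⇒count-minor≡ b c d = ℤ.+-injective (begin
    ℤ.+ (count c (f b) * count d (f c))      ≡⟨ ℤ.pos-* (count c (f b)) (count d (f c)) ⟩
    ℤ.+ count c (f b) ℤ.* ℤ.+ count d (f c)  ≡⟨ ZLinDep⇒minor≡ (pc b c) c d ⟩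
    ℤ.+ count c (f c) ℤ.* ℤ.+ count d (f b)  ≡⟨ ℤ.pos-* (count c (f c)) (count d (f b)) ⟨
    ℤ.+ (count c (f c) * count d (f b))      ∎)
    where open ≡-Reasoning

  length-apply-image : ∀ b → length (apply f (f b)) ≡ eigenvalue f * length (f b)
  length-apply-image b = begin
    length (apply f (f b))
      ≡⟨ length-apply≡∑ f (f b) ⟩
    ∑[ c < s ] (count c (f b) * length (f c))
      ≡⟨ sum-cong-≗ (λ c → trans (cong (count c (f b) *_) (length≡∑count (f c)))
                                  (*-distribˡ-sum (count c (f b)) (λ d → count d (f c)))) ⟩
    ∑[ c < s ] ∑[ d < s ] (count c (f b) * count d (f c))
      ≡⟨ sum-cong-≗ (λ c → sum-cong-≗ (parikhCollinear⇒count-minor≡ b c)) ⟩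
    ∑[ c < s ] ∑[ d < s ] (count c (f c) * count d (f b))
      ≡⟨ sum-cong-≗ (λ c → *-distribˡ-sum (count c (f c)) (λ d → count d (f b))) ⟨
    ∑[ c < s ] (count c (f c) * ∑[ d < s ] count d (f b))
      ≡⟨ *-distribʳ-sum (∑[ d < s ] count d (f b)) (λ c → count c (f c)) ⟨
    (∑[ c < s ] count c (f c)) * (∑[ d < s ] count d (f b))
      ≡⟨ cong₂ _*_ (eigenvalue≡∑ f) (length≡∑count (f b)) ⟨
    eigenvalue f * length (f b) ∎
    where open ≡-Reasoning

  length-apply² : ∀ w → length (apply f (apply f w)) ≡ eigenvalue f * length (apply f w)
  length-apply² []      = sym (*-zeroʳ (eigenvalue f))
  length-apply² (b ∷ w) = begin
    length (apply f (f b ++ apply f w))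
      ≡⟨ length-apply-++ f (f b) (apply f w) ⟩
    length (apply f (f b)) + length (apply f (apply f w))
      ≡⟨ cong₂ _+_ (length-apply-image b) (length-apply² w) ⟩
    eigenvalue f * length (f b) + eigenvalue f * length (apply f w)
      ≡⟨ *-distribˡ-+ (eigenvalue f) (length (f b)) _ ⟨
    eigenvalue f * (length (f b) + length (apply f w))
      ≡⟨ cong (eigenvalue f *_) (length-++ (f b)) ⟨
    eigenvalue f * length (f b ++ apply f w) ∎
    where open ≡-Reasoning

locate : Morphism s → Word s → ℕ → Maybe (Fin s × ℕ)
locate f []      d = nothing
locate f (c ∷ w) d with d <? length (f c)
... | yes _ = just (c , d)
... | no  _ = locate f w (d ∸ length (f c))

locate-here : ∀ (f : Morphism s) c w {d} → d < length (f c) → locate f (c ∷ w) d ≡ just (c , d)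
locate-here f c w {d} d<∣fc∣ with d <? length (f c)
... | yes _      = refl
... | no d≮∣fc∣  = contradiction d<∣fc∣ d≮∣fc∣

locate-there : ∀ (f : Morphism s) c w {d} → ¬ d < length (f c) →
  locate f (c ∷ w) d ≡ locate f w (d ∸ length (f c))
locate-there f c w {d} d≮∣fc∣ with d <? length (f c)
... | yes d<∣fc∣ = contradiction d<∣fc∣ d≮∣fc∣
... | no _       = refl

record Location (f : Morphism s) (w : Word s) (d : ℕ) : Set where
  constructor location
  field
    before after   : Word s
    letter         : Fin s
    offset         : ℕ
    split          : w ≡ before ++ letter ∷ after
    position       : length (apply f before) + offset ≡ d
    offset<length  : offset < length (f letter)
    located        : locate f w d ≡ just (letter , offset)

locate-complete : ∀ (f : Morphism s) w {d} → d < length (apply f w) → Location f w d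
locate-complete f (c ∷ w) {d} d<∣fcw∣ with d <? length (f c)
... | yes d<∣fc∣ = location [] w c d refl refl d<∣fc∣ (locate-here f c w d<∣fc∣)
... | no  d≮∣fc∣ = location (c ∷ before) after letter offset (cong (c ∷_) split) position′ offset<length
                            (trans (locate-there f c w d≮∣fc∣) located)
  where
  ∣fc∣≤d : length (f c) ≤ d
  ∣fc∣≤d = ≮⇒≥ d≮∣fc∣
  d∸∣fc∣<∣fw∣ : d ∸ length (f c) < length (apply f w)
  d∸∣fc∣<∣fw∣ = subst (d ∸ length (f c) <_) (m+n∸m≡n (length (f c)) _)
                      (∸-monoˡ-< (subst (d <_) (length-++ (f c)) d<∣fcw∣) ∣fc∣≤d)
  open Location (locate-complete f w d∸∣fc∣<∣fw∣)
  open ≡-Reasoning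
  position′ : length (f c ++ apply f before) + offset ≡ d
  position′ = begin
    length (f c ++ apply f before) + offset           ≡⟨ cong (_+ offset) (length-++ (f c)) ⟩
    length (f c) + length (apply f before) + offset   ≡⟨ +-assoc (length (f c)) _ offset ⟩
    length (f c) + (length (apply f before) + offset) ≡⟨ cong (length (f c) +_) position ⟩
    length (f c) + (d ∸ length (f c))                 ≡⟨ m+[n∸m]≡n ∣fc∣≤d ⟩
    d                                                 ∎

module _ {k N : ℕ} {State : Set} (encode : State → Fin N) (decode : Fin N → State)
         (decode∘encode : ∀ q → decode (encode q) ≡ q)
         (initial : State) (step : State → Fin k → State) (final : State → Bool) where

  encodedDFA : DFA k
  encodedDFA = record
    { nstates = N
    ; start   = encode initial
    ; δ       = λ i r → encode (step (decode i) r)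
    ; final   = final ∘ decode
    }

  foldl-encode : ∀ w q → foldl (DFA.δ encodedDFA) (encode q) w ≡ encode (foldl step q w)
  foldl-encode []      q = refl
  foldl-encode (r ∷ w) q rewrite decode∘encode q = foldl-encode w (step q r)

  accepts-encodedDFA : ∀ w → accepts encodedDFA w ≡ final (foldl step initial w)
  accepts-encodedDFA w = begin
    final (decode (foldl (DFA.δ encodedDFA) (encode initial) w))
      ≡⟨ cong (final ∘ decode) (foldl-encode w initial) ⟩
    final (decode (encode (foldl step initial w)))
      ≡⟨ cong final (decode∘encode _) ⟩
    final (foldl step initial w) ∎
    where open ≡-Reasoning

module Occurrences (x : ℕ → Fin s) where

  _occursAt_ : Word s → ℕ → Set
  []      occursAt o = ⊤
  (c ∷ w) occursAt o = x o ≡ c × w occursAt suc o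

  occursAt-++ : ∀ u {v o} → (u ++ v) occursAt o → u occursAt o × v occursAt (o + length u)
  occursAt-++ []      {v} {o} v-occ = tt , subst (v occursAt_) (sym (+-identityʳ o)) v-occ
  occursAt-++ (c ∷ u) {v} {o} (xo≡c , occ) =
    let u-occ , v-occ = occursAt-++ u occ
    in (xo≡c , u-occ) , subst (v occursAt_) (sym (+-suc o (length u))) v-occ

  lookup⇒occursAt : ∀ w {o} → (∀ i (i<∣w∣ : i < length w) → x (o + i) ≡ lookup w (fromℕ< i<∣w∣)) →
    w occursAt o
  lookup⇒occursAt []      _     = tt
  lookup⇒occursAt (c ∷ w) {o} agree =
    subst (λ i → x i ≡ c) (+-identityʳ o) (agree 0 (s≤s z≤n)) ,
    lookup⇒occursAt w (λ i i<∣w∣ → subst (λ j → x j ≡ lookup w (fromℕ< i<∣w∣))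
                                         (+-suc o i) (agree (suc i) (s≤s i<∣w∣)))

  pref-occursAt : ∀ w {o} → w occursAt o → pref (o + length w) x ≡ pref o x ++ w
  pref-occursAt []      {o} _ = trans (cong (λ n → pref n x) (+-identityʳ o)) (sym (++-identityʳ _))
  pref-occursAt (c ∷ w) {o} (xo≡c , occ) = begin
    pref (o + suc (length w)) x  ≡⟨ cong (λ n → pref n x) (+-suc o (length w)) ⟩
    pref (suc o + length w) x    ≡⟨ pref-occursAt w occ ⟩
    (pref o x ++ x o ∷ []) ++ w  ≡⟨ ++-assoc (pref o x) _ w ⟩
    pref o x ++ x o ∷ w          ≡⟨ cong (λ d → pref o x ++ d ∷ w) xo≡c ⟩
    pref o x ++ c ∷ w            ∎
    where open ≡-Reasoning

  occursAt0⇒pref-++ : ∀ w n → w occursAt 0 → n ≤ length w → w ≡ pref n x ++ drop n w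
  occursAt0⇒pref-++ w n occ n≤∣w∣ = begin
    w                          ≡⟨ take++drop≡id n w ⟨
    take n w ++ drop n w       ≡⟨ cong (_++ drop n w) take≡pref ⟩
    pref n x ++ drop n w       ∎
    where
    open ≡-Reasoning
    take-occ : take n w occursAt 0
    take-occ = proj₁ (occursAt-++ (take n w) (subst (_occursAt 0) (sym (take++drop≡id n w)) occ))
    take≡pref : take n w ≡ pref n x
    take≡pref = begin
      take n w                       ≡⟨ pref-occursAt (take n w) take-occ ⟨
      pref (length (take n w)) x     ≡⟨ cong (λ m → pref m x) (trans (length-take n w) (m≤n⇒m⊓n≡m n≤∣w∣)) ⟩
      pref n x                       ∎

module CuttingPoints (f : Morphism s) (a : Fin s) (x : ℕ → Fin s) (pc : ParikhCollinear f)
  (prolongable : Prolongable f a) (fixed : IsFixedPointWord f a x) where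

  open Occurrences x

  k : ℕ
  k = eigenvalue f

  cut : ℕ → ℕ
  cut n = length (apply f (pref n x))

  cut-suc : ∀ n → cut (suc n) ≡ cut n + length (f (x n))
  cut-suc n = trans (length-apply-++ f (pref n x) (x n ∷ []))
                    (cong (λ v → cut n + length v) (++-identityʳ (f (x n))))

  cut-mono : ∀ {m n} → m ≤ n → cut m ≤ cut n
  cut-mono {n = zero}  z≤n   = ≤-refl
  cut-mono {n = suc n} m≤1+n with m≤n⇒m<n∨m≡n m≤1+n
  ... | inj₂ refl  = ≤-refl
  ... | inj₁ m<1+n = ≤-trans (cut-mono (s≤s⁻¹ m<1+n))
                             (subst (cut n ≤_) (sym (cut-suc n)) (m≤m+n (cut n) _))

  iterate-occursAt0 : ∀ m → iter f m (a ∷ []) occursAt 0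
  iterate-occursAt0 m = lookup⇒occursAt (iter f m (a ∷ [])) (fixed m)

  image-pref-occursAt0 : ∀ n → apply f (pref n x) occursAt 0
  image-pref-occursAt0 n with proj₂ prolongable n
  ... | m , n≤∣fᵐa∣ =
    proj₁ (occursAt-++ (apply f (pref n x)) (subst (_occursAt 0) split (iterate-occursAt0 (suc m))))
    where
    fᵐa : Word s
    fᵐa = iter f m (a ∷ [])
    split : apply f fᵐa ≡ apply f (pref n x) ++ apply f (drop n fᵐa)
    split = trans (cong (apply f) (occursAt0⇒pref-++ fᵐa n (iterate-occursAt0 m) n≤∣fᵐa∣))
                  (concatMap-++ f (pref n x) (drop n fᵐa))

  pref-cut : ∀ n → pref (cut n) x ≡ apply f (pref n x)
  pref-cut n = pref-occursAt (apply f (pref n x)) (image-pref-occursAt0 n)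

  image-occursAt-cut : ∀ n → f (x n) occursAt cut n
  image-occursAt-cut n = subst (_occursAt cut n) (++-identityʳ (f (x n)))
    (proj₂ (occursAt-++ (apply f (pref n x))
      (subst (_occursAt 0) (concatMap-++ f (pref n x) (x n ∷ [])) (image-pref-occursAt0 (suc n)))))

  image-block : ∀ n {u c v} → f (x n) ≡ u ++ c ∷ v →
    x (cut n + length u) ≡ c × cut (cut n + length u) ≡ k * cut n + length (apply f u)
  image-block n {u} {c} {v} split = proj₁ (proj₂ occurrences) , (begin
    cut (cut n + length u)
      ≡⟨ cong (length ∘ apply f) (pref-occursAt u (proj₁ occurrences)) ⟩
    length (apply f (pref (cut n) x ++ u))
      ≡⟨ length-apply-++ f (pref (cut n) x) u ⟩
    length (apply f (pref (cut n) x)) + length (apply f u)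
      ≡⟨ cong (λ p → length (apply f p) + length (apply f u)) (pref-cut n) ⟩
    length (apply f (apply f (pref n x))) + length (apply f u)
      ≡⟨ cong (_+ length (apply f u)) (length-apply² f pc (pref n x)) ⟩
    k * cut n + length (apply f u) ∎)
    where
    open ≡-Reasoning
    occurrences : u occursAt cut n × (c ∷ v) occursAt (cut n + length u)
    occurrences = occursAt-++ u (subst (_occursAt cut n) split (image-occursAt-cut n))

  record InBlock (q : ℕ) (b : Fin s) (g : ℕ) : Set where
    constructor inBlock
    field
      index          : ℕ
      letter         : x index ≡ b
      position       : cut index + g ≡ q
      offset<length  : g < length (f b)

  inBlock-origin : InBlock 0 a 0
  inBlock-origin = inBlock 0 (fixed 0 0 (s≤s z≤n)) refl 0<∣fa∣
    where
    0<∣fa∣ : 0 < length (f a)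
    0<∣fa∣ with proj₁ prolongable
    ... | u , fa≡au = subst (λ v → 0 < length v) (sym fa≡au) (s≤s z≤n)

  inBlock-step : ∀ {q b g r} → r < k → InBlock q b g →
    Σ (Fin s) λ c → Σ ℕ λ g′ → locate f (f b) (g * k + r) ≡ just (c , g′) × InBlock (q * k + r) c g′
  inBlock-step {q} {b} {g} {r} r<k (inBlock n xn≡b cutn+g≡q g<∣fb∣) =
    letter , offset , located , inBlock (cut n + length before) (proj₁ block) position′ offset<length
    where
    open ≡-Reasoning
    d<∣ffb∣ : g * k + r < length (apply f (f b))
    d<∣ffb∣ = subst (g * k + r <_) (trans (*-comm (length (f b)) k) (sym (length-apply-image f pc b)))
                    (m<n∧r<o⇒m*o+r<n*o g<∣fb∣ r<k)
    open Location (locate-complete f (f b) d<∣ffb∣)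
    block : x (cut n + length before) ≡ letter ×
            cut (cut n + length before) ≡ k * cut n + length (apply f before)
    block = image-block n (trans (cong f xn≡b) split)
    position′ : cut (cut n + length before) + offset ≡ q * k + r
    position′ = begin
      cut (cut n + length before) + offset           ≡⟨ cong (_+ offset) (proj₂ block) ⟩
      k * cut n + length (apply f before) + offset   ≡⟨ +-assoc (k * cut n) _ offset ⟩
      k * cut n + (length (apply f before) + offset) ≡⟨ cong (k * cut n +_) position ⟩
      k * cut n + (g * k + r)                        ≡⟨ horner-distrib k (cut n) g r ⟩
      (cut n + g) * k + r                            ≡⟨ cong (λ p → p * k + r) cutn+g≡q ⟩
      q * k + r                                      ∎

  offset≡0⇔cuttingSet : ∀ {q b g} → InBlock q b g → g ≡ 0 ⇔ CuttingSet f x q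
  offset≡0⇔cuttingSet {q} {b} {g} (inBlock n xn≡b cutn+g≡q g<∣fb∣) = mk⇔ to from
    where
    open ≤-Reasoning
    to : g ≡ 0 → CuttingSet f x q
    to refl = n , trans (sym (+-identityʳ (cut n))) cutn+g≡q
    from : CuttingSet f x q → g ≡ 0
    from (m , cutm≡q) with ≤-<-connex m n
    ... | inj₁ m≤n = n≤0⇒n≡0 (+-cancelˡ-≤ (cut n) g 0 (begin
      cut n + g  ≡⟨ trans cutn+g≡q (sym cutm≡q) ⟩
      cut m      ≤⟨ cut-mono m≤n ⟩
      cut n      ≡⟨ +-identityʳ (cut n) ⟨
      cut n + 0  ∎))
    ... | inj₂ n<m = contradiction (begin-strict
      q                       ≡⟨ cutn+g≡q ⟨
      cut n + g               <⟨ +-monoʳ-< (cut n) (subst (λ c → g < length (f c)) (sym xn≡b) g<∣fb∣) ⟩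
      cut n + length (f (x n)) ≡⟨ cut-suc n ⟨
      cut (suc n)             ≤⟨ cut-mono n<m ⟩
      cut m                   ≡⟨ cutm≡q ⟩
      q                       ∎) (<-irrefl refl)

module CuttingSetAutomaton (f : Morphism s) (a : Fin s) (x : ℕ → Fin s) (pc : ParikhCollinear f)
  (prolongable : Prolongable f a) (fixed : IsFixedPointWord f a x) where

  open CuttingPoints f a x pc prolongable fixed

  G : ℕ
  G = suc (∑[ b < s ] length (f b))

  offset<G : ∀ {q b g} → InBlock q b g → g < G
  offset<G {b = b} block = s≤s (≤-trans (<⇒≤ (InBlock.offset<length block)) (≤-∑ (length ∘ f) b))

  data State : Set where
    initial rejecting : State
    at : Fin s → Fin G → State

  -- The two rejecting cases never occur from a tracked state (inBlock-step, offset<G).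
  enter : Maybe (Fin s × ℕ) → State
  enter nothing = rejecting
  enter (just (c , g)) with g <? G
  ... | yes g<G = at c (fromℕ< g<G)
  ... | no _    = rejecting

  step : State → Fin k → State
  step initial r with toℕ r ℕ.≟ 0
  ... | yes _ = rejecting
  ... | no _  = step (at a zero) r
  step rejecting _ = rejecting
  step (at b g)  r = enter (locate f (f b) (toℕ g * k + toℕ r))

  final : State → Bool
  final initial         = true
  final rejecting       = false
  final (at _ zero)     = true
  final (at _ (suc _))  = false

  encode : State → Fin (2 + s * G)
  encode initial   = zero
  encode rejecting = suc zero
  encode (at b g)  = suc (suc (combine b g))

  decode : Fin (2 + s * G) → State
  decode zero          = initial
  decode (suc zero)    = rejecting
  decode (suc (suc i)) = uncurry at (remQuot G i)

  decode∘encode : ∀ q → decode (encode q) ≡ q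
  decode∘encode initial   = refl
  decode∘encode rejecting = refl
  decode∘encode (at b g)  = cong (uncurry at) (remQuot-combine b g)

  horner : ℕ → List (Fin k) → ℕ
  horner = foldl (λ acc d → acc * k + toℕ d)

  enter-just : ∀ c {g} → g < G → Σ (Fin G) λ i → enter (just (c , g)) ≡ at c i × toℕ i ≡ g
  enter-just c {g} g<G with g <? G
  ... | yes g<G′ = fromℕ< g<G′ , refl , toℕ-fromℕ< g<G′
  ... | no g≮G   = contradiction g<G g≮G

  data Tracks (q : ℕ) : State → Set where
    tracks : ∀ {b g} → InBlock q b (toℕ g) → Tracks q (at b g)

  tracks-step : ∀ {q t} r → Tracks q t → Tracks (q * k + toℕ r) (step t r)
  tracks-step r (tracks block) =
    let c , g′ , found , block′ = inBlock-step (toℕ<n r) block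
        i , entered , i≡g′      = enter-just c (offset<G block′)
    in subst (Tracks _) (sym (trans (cong enter found) entered))
             (tracks (subst (InBlock _ c) (sym i≡g′) block′))

  tracks-run : ∀ w {q t} → Tracks q t → Tracks (horner q w) (foldl step t w)
  tracks-run []      tracked = tracked
  tracks-run (r ∷ w) tracked = tracks-run w (tracks-step r tracked)

  final⇔cuttingSet : ∀ {q t} → Tracks q t → final t ≡ true ⇔ CuttingSet f x q
  final⇔cuttingSet (tracks {g = zero}  block) =
    offset≡0⇔cuttingSet block ⇔-∘ mk⇔ (λ _ → refl) (λ _ → refl)
  final⇔cuttingSet (tracks {g = suc _} block) =
    offset≡0⇔cuttingSet block ⇔-∘ mk⇔ (λ ()) (λ ())

  step-initial-zero : ∀ {r} → toℕ r ≡ 0 → step initial r ≡ rejecting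
  step-initial-zero {r} r≡0 with toℕ r ℕ.≟ 0
  ... | yes _   = refl
  ... | no r≢0  = contradiction r≡0 r≢0

  step-initial-nonzero : ∀ {r} → toℕ r ≢ 0 → step initial r ≡ step (at a zero) r
  step-initial-nonzero {r} r≢0 with toℕ r ℕ.≟ 0
  ... | yes r≡0 = contradiction r≡0 r≢0
  ... | no _    = refl

  foldl-rejecting : ∀ w → foldl step rejecting w ≡ rejecting
  foldl-rejecting []      = refl
  foldl-rejecting (_ ∷ w) = foldl-rejecting w

  final-run⇔ : ∀ w → final (foldl step initial w) ≡ true ⇔ (NoLeadingZero w × CuttingSet f x (val k w))
  final-run⇔ []      = mk⇔ (λ _ → nlz-[] , 0 , refl) (λ _ → refl)
  final-run⇔ (r ∷ w) = leading (toℕ r ℕ.≟ 0)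
    where
    leading : Dec (toℕ r ≡ 0) →
      final (foldl step (step initial r) w) ≡ true ⇔
      (NoLeadingZero (r ∷ w) × CuttingSet f x (val k (r ∷ w)))
    leading (yes r≡0) = mk⇔ (λ accepted → contradiction (trans (sym rejected) accepted) λ ())
                            (λ { (nlz-∷ r≢0 , _) → contradiction r≡0 r≢0 })
      where
      rejected : final (foldl step (step initial r) w) ≡ false
      rejected = trans (cong (λ t → final (foldl step t w)) (step-initial-zero r≡0))
                       (cong final (foldl-rejecting w))
    leading (no r≢0) = mk⇔ (λ accepted → nlz-∷ r≢0 , to accepted) (from ∘ proj₂)
      where
      tracked : Tracks (val k (r ∷ w)) (foldl step (step initial r) w)
      tracked = tracks-run w (subst (Tracks _) (sym (step-initial-nonzero r≢0))
                                    (tracks-step r (tracks inBlock-origin)))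
      open Equivalence (final⇔cuttingSet tracked)

  cuttingSetDFA : DFA k
  cuttingSetDFA = encodedDFA encode decode decode∘encode initial step final

  cuttingSet-kDefinable : KDefinable k (CuttingSet f x)
  cuttingSet-kDefinable = cuttingSetDFA , λ w →
    subst (λ β → β ≡ true ⇔ (NoLeadingZero w × CuttingSet f x (val k w)))
          (sym (accepts-encodedDFA encode decode decode∘encode initial step final w))
          (final-run⇔ w)

proposition14 : (s : ℕ) (f : Morphism s) (a : Fin s) (x : ℕ → Fin s) →
    ParikhCollinear f →
    Prolongable f a →
    (∀ b → ∃ λ n → b ∈ iter f n (a ∷ [])) →
    IsFixedPointWord f a x →
    ¬ UltPeriodic x →
    KDefinable (eigenvalue f) (CuttingSet f x)
proposition14 s f a x pc prolongable _ fixed _ =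
  CuttingSetAutomaton.cuttingSet-kDefinable f a x pc prolongable fixed
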